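{- Let $x\in[-2,2]$ and let $y$ be a binary variable with all bits $y_i^+,y_i^-\in\{0,1\}$, representing $y=\sum_{i=1}^n y_i^+2^{ -i}-\sum_{i=1}^n y_i^-2^{ -i}$, where (by the encoding) at most one of the tuples $(y_i^+)_i,(y_i^-)_i$ is nonzero. Define $$\textsc{ContTimesBin}^\pi(x,y)=\sum_{i=1}^n2^{ -i}\,\textsc{BitMultiply}^{\pi}(x,y_i^+)-\sum_{i=1}^n2^{ -i}\,\textsc{BitMultiply}^{\pi}(x,y_i^-),$$ where each occurrence of $\textsc{BitMultiply}$ uses its own entry of the perturbation vector $\pi$, and all entries of $\pi$ lie in $(-1,1)$. Then $\textsc{ContTimesBin}^\pi(x,y)=x\cdot y+\sigma_{ctb}(\pi)$, where $\sigma_{ctb}(\pi)$ does not depend on $x$ and satisfies $|\sigma_{ctb}(\pi)|\le\max_i|\pi_i|$.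
   Context: For a bit $b\in\{0,1\}$ and perturbation entry $\pi_j$, $\textsc{BitMultiply}^\pi(x,b)=4(1-b)+\max(-4,\ x-8(1-b)+\pi_j)$, where $\pi_j$ is the entry of $\pi$ assigned to that occurrence. An $n$-bit signed binary variable $y$ uses bits $y_1^+,\dots,y_n^+,y_1^-,\dots,y_n^-$: if $y>0$ the $y^+$ bits encode $y$ and all $y_i^-=0$; if $y<0$ the $y^-$ bits encode $-y$ and all $y_i^+=0$; if $y=0$ all bits are $0$.
   Formalization: The variable $x\in[-2,2]$ and the entries of the perturbation vector π are rational numbers instead of reals. -}

module Defs where

open import Data.Nat using (ℕ; zero; suc)
open import Data.Fin using (Fin; toℕ)
open import Data.Bool using (Bool; true; false)
open import Data.Rational using (ℚ; 0ℚ; 1ℚ; ½; _+_; _-_; _*_; _⊔_; ∣_∣; _/_; -_)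
open import Data.Integer using (+_)

bitℚ : Bool → ℚ
bitℚ true  = 1ℚ
bitℚ false = 0ℚ

bitMultiply : ℚ → ℚ → Bool → ℚ
bitMultiply πj x b =
  (+ 4 / 1) * (1ℚ - bitℚ b) + ((- (+ 4 / 1)) ⊔ (x - (+ 8 / 1) * (1ℚ - bitℚ b) + πj))

halfPow : ℕ → ℚ
halfPow zero    = 1ℚ
halfPow (suc k) = ½ * halfPow k

sumFin : (n : ℕ) → (Fin n → ℚ) → ℚ
sumFin zero    f = 0ℚ
sumFin (suc n) f = f Data.Fin.zero + sumFin n (λ i → f (Data.Fin.suc i))

maxAbs : (n : ℕ) → (Fin n → ℚ) → ℚ
maxAbs zero    f = 0ℚ
maxAbs (suc n) f = ∣ f Data.Fin.zero ∣ ⊔ maxAbs n (λ i → f (Data.Fin.suc i))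

-- bit index i : Fin n corresponds to paper index i+1, weight 2^{-(i+1)}
weight : {n : ℕ} → Fin n → ℚ
weight i = halfPow (suc (toℕ i))

binValue : (n : ℕ) → (Fin n → Bool) → (Fin n → Bool) → ℚ
binValue n y⁺ y⁻ =
  sumFin n (λ i → weight i * bitℚ (y⁺ i)) - sumFin n (λ i → weight i * bitℚ (y⁻ i))

-- ContTimesBin^π(x,y); π⁺ i is the entry used for the occurrence with y⁺_i, π⁻ i for y⁻_i
contTimesBin : (n : ℕ) → (π⁺ π⁻ : Fin n → ℚ) → ℚ → (Fin n → Bool) → (Fin n → Bool) → ℚ
contTimesBin n π⁺ π⁻ x y⁺ y⁻ =
  sumFin n (λ i → weight i * bitMultiply (π⁺ i) x (y⁺ i))
  - sumFin n (λ i → weight i * bitMultiply (π⁻ i) x (y⁻ i))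

maxAbsπ : (n : ℕ) → (π⁺ π⁻ : Fin n → ℚ) → ℚ
maxAbsπ n π⁺ π⁻ = maxAbs n π⁺ ⊔ maxAbs n π⁻

{-# OPTIONS --safe #-}
module Submission where

-- For |x| ≤ 2 and |π_j| < 1 the clamp in BitMultiply is inactive when b = 1 and active when b = 0,
-- so BitMultiply^π(x, b) = b (x + π_j) exactly. Summing with the weights 2^{-i} gives
-- ContTimesBin = x y + σ⁺ - σ⁻ with σ^± = Σ_i 2^{-i} y_i^± π_i^±, which does not involve x.
-- One of σ⁺, σ⁻ vanishes by the sign encoding, and the other is a sub-probability
-- combination of entries of π, hence bounded by max_i |π_i|.

open import Defs
open import Data.Nat using (ℕ; zero; suc)
open import Data.Fin using (Fin)
import Data.Fin as Fin
open import Data.Bool using (Bool; false; true)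
open import Data.Rational
  using (ℚ; _<_; _≤_; _*_; _+_; _-_; -_; ∣_∣; _⊔_; 0ℚ; 1ℚ; ½; _/_; _≤?_)
open import Data.Rational.Properties
open import Data.Rational.Solver using (module +-*-Solver)
open import Data.Integer using (+_)
open import Data.Product using (Σ; _×_; _,_)
open import Data.Sum using (_⊎_; inj₁; inj₂)
open import Data.Unit using (tt)
open import Function using (_∘_)
open import Relation.Binary.PropositionalEquality
open import Relation.Nullary.Decidable using (toWitness)
open +-*-Solver

-4≤_≤4 : ℚ → Set
-4≤ q ≤4 = - (+ 4 / 1) ≤ q × q ≤ + 4 / 1

-4≤x+p≤4 : ∀ {x p} → - (+ 2 / 1) ≤ x → x ≤ + 2 / 1 → - 1ℚ < p × p < 1ℚ → -4≤ x + p ≤4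
-4≤x+p≤4 -2≤x x≤2 (-1<p , p<1) =
  ≤-trans (toWitness {a? = - (+ 4 / 1) ≤? - (+ 2 / 1) + - 1ℚ} tt) (+-mono-≤ -2≤x (<⇒≤ -1<p)) ,
  ≤-trans (+-mono-≤ x≤2 (<⇒≤ p<1)) (toWitness {a? = + 2 / 1 + 1ℚ ≤? + 4 / 1} tt)

bitMultiply-true : ∀ p x → - (+ 4 / 1) ≤ x + p → bitMultiply p x true ≡ x + p
bitMultiply-true p x -4≤x+p = begin
  0ℚ + (- (+ 4 / 1) ⊔ (x + 0ℚ + p))  ≡⟨ +-identityˡ _ ⟩
  - (+ 4 / 1) ⊔ (x + 0ℚ + p)         ≡⟨ cong (λ q → - (+ 4 / 1) ⊔ (q + p)) (+-identityʳ x) ⟩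
  - (+ 4 / 1) ⊔ (x + p)              ≡⟨ p≤q⇒p⊔q≡q -4≤x+p ⟩
  x + p                              ∎
  where open ≡-Reasoning

bitMultiply-false : ∀ p x → x + p ≤ + 4 / 1 → bitMultiply p x false ≡ 0ℚ
bitMultiply-false p x x+p≤4 = cong (_+_ (+ 4 / 1)) (p≥q⇒p⊔q≡p clamped)
  where
  clamped : x - + 8 / 1 + p ≤ - (+ 4 / 1)
  clamped = begin
    x - + 8 / 1 + p  ≡⟨ solve 2 (λ x p → x :- con (+ 8 / 1) :+ p := x :+ p :- con (+ 8 / 1)) refl x p ⟩
    x + p - + 8 / 1  ≤⟨ +-monoˡ-≤ (- (+ 8 / 1)) x+p≤4 ⟩
    - (+ 4 / 1)      ∎
    where open ≤-Reasoning

bitMultiply-exact : ∀ p x b → -4≤ x + p ≤4 → bitMultiply p x b ≡ bitℚ b * (x + p)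
bitMultiply-exact p x true  (-4≤x+p , _) = trans (bitMultiply-true p x -4≤x+p) (sym (*-identityˡ (x + p)))
bitMultiply-exact p x false (_ , x+p≤4)  = trans (bitMultiply-false p x x+p≤4) (sym (*-zeroˡ (x + p)))

sumFin-cong : ∀ n {f g : Fin n → ℚ} → (∀ i → f i ≡ g i) → sumFin n f ≡ sumFin n g
sumFin-cong zero    f≗g = refl
sumFin-cong (suc n) f≗g = cong₂ _+_ (f≗g Fin.zero) (sumFin-cong n (f≗g ∘ Fin.suc))

sumFin-zero : ∀ n → sumFin n (λ _ → 0ℚ) ≡ 0ℚ
sumFin-zero zero    = refl
sumFin-zero (suc n) = trans (+-identityˡ _) (sumFin-zero n)

sumFin-distrib-+ : ∀ n (f g : Fin n → ℚ) → sumFin n (λ i → f i + g i) ≡ sumFin n f + sumFin n g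
sumFin-distrib-+ zero    f g = refl
sumFin-distrib-+ (suc n) f g = begin
  f₀ + g₀ + sumFin n (λ i → f (Fin.suc i) + g (Fin.suc i))
    ≡⟨ cong (_+_ (f₀ + g₀)) (sumFin-distrib-+ n (f ∘ Fin.suc) (g ∘ Fin.suc)) ⟩
  f₀ + g₀ + (F + G)
    ≡⟨ solve 4 (λ a b c d → a :+ b :+ (c :+ d) := a :+ c :+ (b :+ d)) refl f₀ g₀ F G ⟩
  f₀ + F + (g₀ + G) ∎
  where
  open ≡-Reasoning
  f₀ = f Fin.zero
  g₀ = g Fin.zero
  F = sumFin n (f ∘ Fin.suc)
  G = sumFin n (g ∘ Fin.suc)

*-distribˡ-sumFin : ∀ n c (f : Fin n → ℚ) → c * sumFin n f ≡ sumFin n (λ i → c * f i)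
*-distribˡ-sumFin zero    c f = *-zeroʳ c
*-distribˡ-sumFin (suc n) c f =
  trans (*-distribˡ-+ c (f Fin.zero) _)
        (cong (_+_ (c * f Fin.zero)) (*-distribˡ-sumFin n c (f ∘ Fin.suc)))

weightedSum : (n : ℕ) → (Fin n → ℚ) → ℚ
weightedSum n f = sumFin n (λ i → weight i * f i)

weightedSum-suc : ∀ n (f : Fin (suc n) → ℚ) →
  weightedSum (suc n) f ≡ ½ * (f Fin.zero + weightedSum n (f ∘ Fin.suc))
weightedSum-suc n f = begin
  ½ * 1ℚ * f₀ + sumFin n (λ i → ½ * weight i * f (Fin.suc i))
    ≡⟨ cong (_+_ (½ * 1ℚ * f₀)) (sumFin-cong n (λ i → *-assoc ½ (weight i) (f (Fin.suc i)))) ⟩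
  ½ * 1ℚ * f₀ + sumFin n (λ i → ½ * (weight i * f (Fin.suc i)))
    ≡⟨ cong (_+_ (½ * 1ℚ * f₀)) (sym (*-distribˡ-sumFin n ½ _)) ⟩
  ½ * 1ℚ * f₀ + ½ * S
    ≡⟨ solve 2 (λ a s → con ½ :* con 1ℚ :* a :+ con ½ :* s := con ½ :* (a :+ s)) refl f₀ S ⟩
  ½ * (f₀ + S) ∎
  where
  open ≡-Reasoning
  f₀ = f Fin.zero
  S = weightedSum n (f ∘ Fin.suc)

∣weightedSum∣≤ : ∀ n (f : Fin n → ℚ) {M} → 0ℚ ≤ M → (∀ i → ∣ f i ∣ ≤ M) →
  ∣ weightedSum n f ∣ ≤ M
∣weightedSum∣≤ zero    f 0≤M ∣f∣≤M = 0≤M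
∣weightedSum∣≤ (suc n) f {M} 0≤M ∣f∣≤M = begin
  ∣ weightedSum (suc n) f ∣  ≡⟨ cong ∣_∣ (weightedSum-suc n f) ⟩
  ∣ ½ * (f₀ + S) ∣           ≡⟨ ∣p*q∣≡∣p∣*∣q∣ ½ (f₀ + S) ⟩
  ½ * ∣ f₀ + S ∣             ≤⟨ *-monoˡ-≤-nonNeg ½ (∣p+q∣≤∣p∣+∣q∣ f₀ S) ⟩
  ½ * (∣ f₀ ∣ + ∣ S ∣)       ≤⟨ *-monoˡ-≤-nonNeg ½ (+-mono-≤ (∣f∣≤M Fin.zero) ∣S∣≤M) ⟩
  ½ * (M + M)                ≡⟨ solve 1 (λ m → con ½ :* (m :+ m) := m) refl M ⟩
  M                          ∎
  where
  open ≤-Reasoning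
  f₀ = f Fin.zero
  S = weightedSum n (f ∘ Fin.suc)
  ∣S∣≤M : ∣ S ∣ ≤ M
  ∣S∣≤M = ∣weightedSum∣≤ n (f ∘ Fin.suc) 0≤M (∣f∣≤M ∘ Fin.suc)

0≤maxAbs : ∀ n (f : Fin n → ℚ) → 0ℚ ≤ maxAbs n f
0≤maxAbs zero    f = ≤-refl
0≤maxAbs (suc n) f = ≤-trans (0≤∣p∣ (f Fin.zero)) (p≤p⊔q _ _)

∣f∣≤maxAbs : ∀ n (f : Fin n → ℚ) i → ∣ f i ∣ ≤ maxAbs n f
∣f∣≤maxAbs (suc n) f Fin.zero    = p≤p⊔q _ _
∣f∣≤maxAbs (suc n) f (Fin.suc i) = ≤-trans (∣f∣≤maxAbs n (f ∘ Fin.suc) i) (p≤q⊔p ∣ f Fin.zero ∣ _)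

∣bit*p∣≤∣p∣ : ∀ b p → ∣ bitℚ b * p ∣ ≤ ∣ p ∣
∣bit*p∣≤∣p∣ true  p = ≤-reflexive (cong ∣_∣ (*-identityˡ p))
∣bit*p∣≤∣p∣ false p = ≤-trans (≤-reflexive (cong ∣_∣ (*-zeroˡ p))) (0≤∣p∣ p)

bitPerturbation : (n : ℕ) → (Fin n → ℚ) → (Fin n → Bool) → ℚ
bitPerturbation n π y = weightedSum n (λ i → bitℚ (y i) * π i)

bitPerturbation-allFalse : ∀ n π (y : Fin n → Bool) → (∀ i → y i ≡ false) →
  bitPerturbation n π y ≡ 0ℚ
bitPerturbation-allFalse n π y y≡false = trans
  (sumFin-cong n (λ i → begin
    weight i * (bitℚ (y i) * π i)  ≡⟨ cong (λ b → weight i * (bitℚ b * π i)) (y≡false i) ⟩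
    weight i * (0ℚ * π i)          ≡⟨ cong (weight i *_) (*-zeroˡ (π i)) ⟩
    weight i * 0ℚ                  ≡⟨ *-zeroʳ (weight i) ⟩
    0ℚ                             ∎))
  (sumFin-zero n)
  where open ≡-Reasoning

∣bitPerturbation∣≤maxAbs : ∀ n π (y : Fin n → Bool) → ∣ bitPerturbation n π y ∣ ≤ maxAbs n π
∣bitPerturbation∣≤maxAbs n π y = ∣weightedSum∣≤ n (λ i → bitℚ (y i) * π i) (0≤maxAbs n π)
  (λ i → ≤-trans (∣bit*p∣≤∣p∣ (y i) (π i)) (∣f∣≤maxAbs n π i))

weightedSum-bitMultiply : ∀ n π x (y : Fin n → Bool) → (∀ i → -4≤ x + π i ≤4) →
  weightedSum n (λ i → bitMultiply (π i) x (y i))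
    ≡ x * weightedSum n (bitℚ ∘ y) + bitPerturbation n π y
weightedSum-bitMultiply n π x y inRange = begin
  weightedSum n (λ i → bitMultiply (π i) x (y i))
    ≡⟨ sumFin-cong n termwise ⟩
  sumFin n (λ i → x * (weight i * bitℚ (y i)) + weight i * (bitℚ (y i) * π i))
    ≡⟨ sumFin-distrib-+ n _ _ ⟩
  sumFin n (λ i → x * (weight i * bitℚ (y i))) + bitPerturbation n π y
    ≡⟨ cong (_+ bitPerturbation n π y) (sym (*-distribˡ-sumFin n x _)) ⟩
  x * weightedSum n (bitℚ ∘ y) + bitPerturbation n π y ∎
  where
  open ≡-Reasoning
  termwise : ∀ i → weight i * bitMultiply (π i) x (y i)
                   ≡ x * (weight i * bitℚ (y i)) + weight i * (bitℚ (y i) * π i)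
  termwise i = trans (cong (weight i *_) (bitMultiply-exact (π i) x (y i) (inRange i)))
    (solve 4 (λ w b x p → w :* (b :* (x :+ p)) := x :* (w :* b) :+ w :* (b :* p)) refl
      (weight i) (bitℚ (y i)) x (π i))

contTimesBinError : (n : ℕ) → (π⁺ π⁻ : Fin n → ℚ) → (y⁺ y⁻ : Fin n → Bool) → ℚ
contTimesBinError n π⁺ π⁻ y⁺ y⁻ = bitPerturbation n π⁺ y⁺ - bitPerturbation n π⁻ y⁻

contTimesBin-exact : ∀ n π⁺ π⁻ x (y⁺ y⁻ : Fin n → Bool) →
  (∀ i → -4≤ x + π⁺ i ≤4) → (∀ i → -4≤ x + π⁻ i ≤4) →
  contTimesBin n π⁺ π⁻ x y⁺ y⁻ ≡ x * binValue n y⁺ y⁻ + contTimesBinError n π⁺ π⁻ y⁺ y⁻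
contTimesBin-exact n π⁺ π⁻ x y⁺ y⁻ inRange⁺ inRange⁻ = begin
  contTimesBin n π⁺ π⁻ x y⁺ y⁻
    ≡⟨ cong₂ _-_ (weightedSum-bitMultiply n π⁺ x y⁺ inRange⁺)
                 (weightedSum-bitMultiply n π⁻ x y⁻ inRange⁻) ⟩
  (x * B⁺ + σ⁺) - (x * B⁻ + σ⁻)
    ≡⟨ solve 5 (λ x a b s t → (x :* a :+ s) :- (x :* b :+ t) := x :* (a :- b) :+ (s :- t))
               refl x B⁺ B⁻ σ⁺ σ⁻ ⟩
  x * (B⁺ - B⁻) + (σ⁺ - σ⁻) ∎
  where
  open ≡-Reasoning
  B⁺ = weightedSum n (bitℚ ∘ y⁺)
  B⁻ = weightedSum n (bitℚ ∘ y⁻)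
  σ⁺ = bitPerturbation n π⁺ y⁺
  σ⁻ = bitPerturbation n π⁻ y⁻

∣contTimesBinError∣≤maxAbsπ : ∀ n π⁺ π⁻ (y⁺ y⁻ : Fin n → Bool) →
  (∀ i → y⁺ i ≡ false) ⊎ (∀ i → y⁻ i ≡ false) →
  ∣ contTimesBinError n π⁺ π⁻ y⁺ y⁻ ∣ ≤ maxAbsπ n π⁺ π⁻
∣contTimesBinError∣≤maxAbsπ n π⁺ π⁻ y⁺ y⁻ (inj₁ y⁺≡false) = begin
  ∣ σ⁺ - σ⁻ ∣  ≡⟨ cong (λ s → ∣ s - σ⁻ ∣) (bitPerturbation-allFalse n π⁺ y⁺ y⁺≡false) ⟩
  ∣ 0ℚ - σ⁻ ∣  ≡⟨ cong ∣_∣ (+-identityˡ (- σ⁻)) ⟩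
  ∣ - σ⁻ ∣     ≡⟨ ∣-p∣≡∣p∣ σ⁻ ⟩
  ∣ σ⁻ ∣       ≤⟨ ∣bitPerturbation∣≤maxAbs n π⁻ y⁻ ⟩
  maxAbs n π⁻  ≤⟨ p≤q⊔p (maxAbs n π⁺) _ ⟩
  maxAbsπ n π⁺ π⁻ ∎
  where
  open ≤-Reasoning
  σ⁺ = bitPerturbation n π⁺ y⁺
  σ⁻ = bitPerturbation n π⁻ y⁻
∣contTimesBinError∣≤maxAbsπ n π⁺ π⁻ y⁺ y⁻ (inj₂ y⁻≡false) = begin
  ∣ σ⁺ - σ⁻ ∣  ≡⟨ cong (λ s → ∣ σ⁺ - s ∣) (bitPerturbation-allFalse n π⁻ y⁻ y⁻≡false) ⟩
  ∣ σ⁺ - 0ℚ ∣  ≡⟨ cong ∣_∣ (+-identityʳ σ⁺) ⟩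
  ∣ σ⁺ ∣       ≤⟨ ∣bitPerturbation∣≤maxAbs n π⁺ y⁺ ⟩
  maxAbs n π⁺  ≤⟨ p≤p⊔q _ (maxAbs n π⁻) ⟩
  maxAbsπ n π⁺ π⁻ ∎
  where
  open ≤-Reasoning
  σ⁺ = bitPerturbation n π⁺ y⁺
  σ⁻ = bitPerturbation n π⁻ y⁻

lemma5p6 : (n : ℕ) (π⁺ π⁻ : Fin n → ℚ)
    → (∀ i → - 1ℚ < π⁺ i × π⁺ i < 1ℚ)
    → (∀ i → - 1ℚ < π⁻ i × π⁻ i < 1ℚ)
    → (y⁺ y⁻ : Fin n → Bool)
    → ((∀ i → y⁺ i ≡ false) ⊎ (∀ i → y⁻ i ≡ false))
    → Σ ℚ (λ σ →
        (∀ (x : ℚ) → - (+ 2 / 1) ≤ x → x ≤ + 2 / 1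
           → contTimesBin n π⁺ π⁻ x y⁺ y⁻ ≡ x * binValue n y⁺ y⁻ + σ)
        × ∣ σ ∣ ≤ maxAbsπ n π⁺ π⁻)
lemma5p6 n π⁺ π⁻ π⁺-bounds π⁻-bounds y⁺ y⁻ oneSided =
  contTimesBinError n π⁺ π⁻ y⁺ y⁻ ,
  (λ x -2≤x x≤2 → contTimesBin-exact n π⁺ π⁻ x y⁺ y⁻
     (-4≤x+p≤4 -2≤x x≤2 ∘ π⁺-bounds) (-4≤x+p≤4 -2≤x x≤2 ∘ π⁻-bounds)) ,
  ∣contTimesBinError∣≤maxAbsπ n π⁺ π⁻ y⁺ y⁻ oneSided
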